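{- Let $G$ be a connected $(P_5,2K_1\cup K_2)$-free graph. Then $cop(G)\leq 2$.
   Context: All graphs are finite, simple and undirected. $P_n$ and $K_n$ denote the path and complete graph on $n$ vertices; $G\cup H$ denotes the disjoint union and $rG$ the disjoint union of $r$ copies of $G$, so $2K_1\cup K_2$ is an edge plus two isolated vertices. A graph is $(H_1,\dots,H_k)$-free if it contains no induced subgraph isomorphic to any $H_i$. Game of cops and robber on a connected graph: first all cops are placed on vertices (several may share a vertex), then the robber chooses a vertex; afterwards cops and robber move alternately, starting with the cops, a move consisting of staying put or moving to an adjacent vertex. The cops win if after finitely many rounds some cop is on the same vertex as the robber. The cop number $cop(G)$ is the minimum number of cops that guarantees a win in each connected component of $G$. -}

module Defs where

open import Data.Nat using (ℕ; zero; suc; _+_; _≡ᵇ_; _≤_)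
open import Data.Nat.Properties using (+-comm; +-suc)
open import Data.Bool using (Bool; true; false; _∨_)
open import Data.Bool.Properties using (∨-comm)
open import Data.Fin using (Fin; toℕ)
open import Data.Product using (Σ; ∃; _×_; _,_)
open import Data.Sum using (_⊎_)
open import Relation.Nullary using (¬_)
open import Function.Definitions using (Injective)
open import Relation.Binary.PropositionalEquality using (_≡_; refl; cong)

record Graph (n : ℕ) : Set where
  field
    adj    : Fin n → Fin n → Bool
    sym    : ∀ u v → adj u v ≡ adj v u
    irrefl : ∀ u → adj u u ≡ false
open Graph public

ContainsInduced : ∀ {n m} → Graph n → Graph m → Set
ContainsInduced {n} {m} G H =
  Σ (Fin m → Fin n) λ f → Injective _≡_ _≡_ f × (∀ i j → adj H i j ≡ adj G (f i) (f j))

Free : ∀ {n m} → Graph n → Graph m → Set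
Free G H = ¬ ContainsInduced G H

private
  suc≢ : ∀ k → (suc k ≡ᵇ k) ≡ false
  suc≢ zero = refl
  suc≢ (suc k) = suc≢ k

  dbl≢1 : ∀ k → (k + k ≡ᵇ 1) ≡ false
  dbl≢1 zero = refl
  dbl≢1 (suc zero) = refl
  dbl≢1 (suc (suc k)) = refl

P₅ : Graph 5
P₅ = record
  { adj    = λ i j → (suc (toℕ i) ≡ᵇ toℕ j) ∨ (suc (toℕ j) ≡ᵇ toℕ i)
  ; sym    = λ i j → ∨-comm (suc (toℕ i) ≡ᵇ toℕ j) (suc (toℕ j) ≡ᵇ toℕ i)
  ; irrefl = λ i → lem (toℕ i)
  }
  where
  lem : ∀ k → ((suc k ≡ᵇ k) ∨ (suc k ≡ᵇ k)) ≡ false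
  lem k rewrite suc≢ k = refl

-- 2K₁ ∪ K₂: four vertices, the only edge being between vertices 0 and 1.
2K₁∪K₂ : Graph 4
2K₁∪K₂ = record
  { adj    = λ i j → toℕ i + toℕ j ≡ᵇ 1
  ; sym    = λ i j → cong (_≡ᵇ 1) (+-comm (toℕ i) (toℕ j))
  ; irrefl = λ i → dbl≢1 (toℕ i)
  }

data Reach {n} (G : Graph n) : Fin n → Fin n → Set where
  here : ∀ {u} → Reach G u u
  step : ∀ {u v w} → adj G u v ≡ true → Reach G v w → Reach G u w

Connected : ∀ {n} → Graph n → Set
Connected {n} G = ∀ (u v : Fin n) → Reach G u v

Move : ∀ {n} → Graph n → Fin n → Fin n → Set
Move G u v = u ≡ v ⊎ adj G u v ≡ true

Caught : ∀ {n k} → (Fin k → Fin n) → Fin n → Set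
Caught c r = ∃ λ i → c i ≡ r

-- CopsWinFrom G c r: it is the cops' turn, cops at c, robber at r, and the
-- cops can force capture in finitely many rounds (inductive = well-founded
-- game tree, hence finitely many rounds).
data CopsWinFrom {n k} (G : Graph n) : (Fin k → Fin n) → Fin n → Set where
  win : ∀ {c r} (c′ : Fin k → Fin n) →
        (∀ i → Move G (c i) (c′ i)) →
        (Caught c′ r ⊎ (∀ r′ → Move G r r′ → Caught c′ r′ ⊎ CopsWinFrom G c′ r′)) →
        CopsWinFrom G c r

CopsWin : ∀ {n} → ℕ → Graph n → Set
CopsWin {n} k G =
  Σ (Fin k → Fin n) λ c → ∀ (r : Fin n) → Caught c r ⊎ CopsWinFrom G c r

CopNumber≤ : ∀ {n} → Graph n → ℕ → Set
CopNumber≤ G k = ∃ λ m → m ≤ k × CopsWin m G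

{-# OPTIONS --safe #-}
module Submission where

-- If two vertices dominate G, two cops standing on them catch the robber at once. Otherwise every
-- pair of vertices leaves some vertex undominated, and for an edge this vertex is unique, since two
-- of them would complete an induced 2K₁ ∪ K₂ or P₅. The vertices missed by a non-adjacent pair
-- q₁, q₂ form an independent set A, and a vertex outside A misses at most one vertex of A. This
-- gives x ∈ A with neighbours y₁, y₂ whose undominated vertices m₁, m₂ ∈ A are distinct: cops on x
-- and y₁ confine the robber to m₁, and after they step to y₂ and x he cannot reach m₂.

open import Defs
open import Data.Nat using (ℕ; zero; suc; z≤n)
open import Data.Nat.Properties using (≤-refl)
open import Data.Bool using (true; false)
open import Data.Bool.Properties using (¬-not)
import Data.Bool as Bool
open import Data.Fin using (Fin; _≟_; Fin′; inject; compare; less; equal; greater)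
open import Data.Fin.Patterns using (0F; 1F; 2F; 3F; 4F)
open import Data.Fin.Properties using (any?; all?; ¬∀⟶∃¬)
open import Data.Vec.Functional using ([]; _∷_)
open import Data.Product using (∃; ∃₂; _×_; _,_; proj₁; proj₂)
open import Data.Sum using (_⊎_; inj₁; inj₂)
open import Data.Empty using (⊥; ⊥-elim)
open import Relation.Nullary using (¬_; Dec; yes; no)
open import Relation.Nullary.Decidable using (_⊎-dec_; _×-dec_)
open import Relation.Binary.PropositionalEquality as ≡ using (_≡_; _≢_; refl)

one-of-three-avoids-two : ∀ {n} {P : Fin n → Set} {a b c} → P a → P b → P c → a ≢ b → a ≢ c → b ≢ c →
                          ∀ u v → ∃ λ x → P x × x ≢ u × x ≢ v
one-of-three-avoids-two {a = a} {b} {c} Pa Pb Pc a≢b a≢c b≢c u v with a ≟ u | a ≟ v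
... | no a≢u | no a≢v = a , Pa , a≢u , a≢v
... | yes refl | _ with b ≟ v
...   | no b≢v   = b , Pb , ≡.≢-sym a≢b , b≢v
...   | yes refl = c , Pc , ≡.≢-sym a≢c , ≡.≢-sym b≢c
one-of-three-avoids-two {a = a} {b} {c} Pa Pb Pc a≢b a≢c b≢c u v | no _ | yes refl with b ≟ u
...   | no b≢u   = b , Pb , b≢u , ≡.≢-sym a≢b
...   | yes refl = c , Pc , ≡.≢-sym b≢c , ≡.≢-sym a≢c

module _ {n : ℕ} (G : Graph n) where

  induced-copy : ∀ {m} (H : Graph m) (f : Fin m → Fin n) →
                 (∀ j (i : Fin′ j) → f (inject i) ≢ f j × adj G (f (inject i)) (f j) ≡ adj H (inject i) j) →
                 ContainsInduced G H
  induced-copy H f upper = f , injective , agree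
    where
    injective : ∀ {i j} → f i ≡ f j → i ≡ j
    injective {i} {j} fi≡fj with compare i j
    ... | less j i′    = ⊥-elim (proj₁ (upper j i′) fi≡fj)
    ... | equal i      = refl
    ... | greater i j′ = ⊥-elim (proj₁ (upper i j′) (≡.sym fi≡fj))

    agree : ∀ i j → adj H i j ≡ adj G (f i) (f j)
    agree i j with compare i j
    ... | less j i′    = ≡.sym (proj₂ (upper j i′))
    ... | equal i      = ≡.trans (irrefl H i) (≡.sym (irrefl G (f i)))
    ... | greater i j′ = ≡.trans (sym H i (inject j′))
                           (≡.trans (≡.sym (proj₂ (upper i j′))) (sym G (f (inject j′)) (f i)))

  infix 4 _~_ _≁_

  _~_ : Fin n → Fin n → Set
  u ~ v = adj G u v ≡ true

  _≁_ : Fin n → Fin n → Set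
  u ≁ v = adj G u v ≡ false

  ~-sym : ∀ {u v} → u ~ v → v ~ u
  ~-sym {u} {v} uv = ≡.trans (sym G v u) uv

  ≁-sym : ∀ {u v} → u ≁ v → v ≁ u
  ≁-sym {u} {v} u≁v = ≡.trans (sym G v u) u≁v

  ~-≁-absurd : ∀ {u v} → u ~ v → u ≁ v → ⊥
  ~-≁-absurd uv u≁v with ≡.trans (≡.sym uv) u≁v
  ... | ()

  ~⇒≢ : ∀ {u v} → u ~ v → u ≢ v
  ~⇒≢ {u} uv refl = ~-≁-absurd uv (irrefl G u)

  ~≁⇒≢ : ∀ {u v w} → w ~ u → w ≁ v → u ≢ v
  ~≁⇒≢ wu w≁v refl = ~-≁-absurd wu w≁v

  has-neighbour : ∀ {p q} → Reach G p q → p ≢ q → ∃ (p ~_)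
  has-neighbour here        p≢p = ⊥-elim (p≢p refl)
  has-neighbour (step pz _) _   = _ , pz

  Near : Fin n → Fin n → Set
  Near u v = v ≡ u ⊎ u ~ v

  Far : Fin n → Fin n → Set
  Far u v = v ≢ u × u ≁ v

  far-sym : ∀ {u v} → Far u v → Far v u
  far-sym (v≢u , u≁v) = ≡.≢-sym v≢u , ≁-sym u≁v

  Dominating : Fin n → Fin n → Set
  Dominating p q = ∀ t → Near p t ⊎ Near q t

  Undominated : Fin n → Fin n → Fin n → Set
  Undominated p q t = Far p t × Far q t

  near? : ∀ u v → Dec (Near u v)
  near? u v = (v ≟ u) ⊎-dec (adj G u v Bool.≟ true)

  ¬near⇒far : ∀ {u v} → ¬ Near u v → Far u v
  ¬near⇒far ¬near = (λ v≡u → ¬near (inj₁ v≡u)) , ¬-not (λ uv → ¬near (inj₂ uv))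

  ¬dominated⇒undominated : ∀ {p q t} → ¬ (Near p t ⊎ Near q t) → Undominated p q t
  ¬dominated⇒undominated ¬dominated = ¬near⇒far (λ near → ¬dominated (inj₁ near)) ,
                                      ¬near⇒far (λ near → ¬dominated (inj₂ near))

  dominated-or-undominated : ∀ p q t → (Near p t ⊎ Near q t) ⊎ Undominated p q t
  dominated-or-undominated p q t with near? p t ⊎-dec near? q t
  ... | yes dominated = inj₁ dominated
  ... | no ¬dominated = inj₂ (¬dominated⇒undominated ¬dominated)

  dominating-pair-or-undominated : (∃₂ Dominating) ⊎ (∀ p q → ∃ (Undominated p q))
  dominating-pair-or-undominated with any? (λ p → any? (λ q → all? (λ t → near? p t ⊎-dec near? q t)))
  ... | yes (p , q , dominating) = inj₁ (p , q , dominating)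
  ... | no ¬dominating-pair = inj₂ undominated
    where
    undominated : ∀ p q → ∃ (Undominated p q)
    undominated p q with ¬∀⟶∃¬ n _ (λ t → near? p t ⊎-dec near? q t)
                                     (λ dominating → ¬dominating-pair (p , q , dominating))
    ... | t , ¬dominated = t , ¬dominated⇒undominated ¬dominated

  cops-at : Fin n → Fin n → Fin 2 → Fin n
  cops-at p q = p ∷ q ∷ []

  capture-dominated : ∀ {p q t} → Near p t ⊎ Near q t →
                      Caught (cops-at p q) t ⊎ CopsWinFrom G (cops-at p q) t
  capture-dominated (inj₁ (inj₁ t≡p)) = inj₁ (0F , ≡.sym t≡p)
  capture-dominated (inj₂ (inj₁ t≡q)) = inj₁ (1F , ≡.sym t≡q)
  capture-dominated {p} {q} {t} (inj₁ (inj₂ pt)) = inj₂ (win (cops-at t q) moves (inj₁ (0F , refl)))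
    where
    moves : ∀ i → Move G (cops-at p q i) (cops-at t q i)
    moves 0F = inj₂ pt
    moves 1F = inj₁ refl
  capture-dominated {p} {q} {t} (inj₂ (inj₂ qt)) = inj₂ (win (cops-at p t) moves (inj₁ (1F , refl)))
    where
    moves : ∀ i → Move G (cops-at p q i) (cops-at p t i)
    moves 0F = inj₁ refl
    moves 1F = inj₂ qt

  dominating-pair-wins : ∀ {p q} → Dominating p q → CopsWin 2 G
  dominating-pair-wins {p} {q} dominating = cops-at p q , λ t → capture-dominated (dominating t)

  chase-wins : ∀ {x y a} → x ~ y → x ~ a →
               (∀ {t t′} → Undominated x y t → Move G t t′ → Near a t′ ⊎ Near x t′) →
               CopsWin 2 G
  chase-wins {x} {y} {a} xy xa escape-dominated = cops-at x y , start
    where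
    moves : ∀ i → Move G (cops-at x y i) (cops-at a x i)
    moves 0F = inj₂ xa
    moves 1F = inj₂ (~-sym xy)

    start : ∀ t → Caught (cops-at x y) t ⊎ CopsWinFrom G (cops-at x y) t
    start t with dominated-or-undominated x y t
    ... | inj₁ dominated   = capture-dominated dominated
    ... | inj₂ undominated =
      inj₂ (win (cops-at a x) moves (inj₂ λ t′ t→t′ → capture-dominated (escape-dominated undominated t→t′)))

  module _ (2K₁∪K₂-free : Free G 2K₁∪K₂) where

    ¬2K₁∪K₂ : ∀ {a b c d} → a ~ b → a ≁ c → a ≁ d → b ≁ c → b ≁ d → c ≁ d → c ≢ d → ⊥
    ¬2K₁∪K₂ {a} {b} {c} {d} ab a≁c a≁d b≁c b≁d c≁d c≢d =
      2K₁∪K₂-free (induced-copy 2K₁∪K₂ vertex upper)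
      where
      vertex : Fin 4 → Fin n
      vertex = a ∷ b ∷ c ∷ d ∷ []

      upper : ∀ j (i : Fin′ j) → vertex (inject i) ≢ vertex j ×
                                  adj G (vertex (inject i)) (vertex j) ≡ adj 2K₁∪K₂ (inject i) j
      upper 1F 0F = ~⇒≢ ab , ab
      upper 2F 0F = ~≁⇒≢ (~-sym ab) b≁c , a≁c
      upper 2F 1F = ~≁⇒≢ ab a≁c , b≁c
      upper 3F 0F = ~≁⇒≢ (~-sym ab) b≁d , a≁d
      upper 3F 1F = ~≁⇒≢ ab a≁d , b≁d
      upper 3F 2F = c≢d , c≁d

    far-from-edge⇒adjacent : ∀ {a b t t′} → a ~ b → Undominated a b t → Undominated a b t′ →
                             t ≢ t′ → t ~ t′
    far-from-edge⇒adjacent {t = t} {t′} ab ((_ , a≁t) , (_ , b≁t)) ((_ , a≁t′) , (_ , b≁t′)) t≢t′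
      with adj G t t′ in tt′
    ... | true  = refl
    ... | false = ⊥-elim (¬2K₁∪K₂ ab a≁t a≁t′ b≁t b≁t′ tt′ t≢t′)

    far-from-non-edge⇒non-adjacent : ∀ {a b u v} → a ≁ b → a ≢ b →
                                      a ≁ u → b ≁ u → a ≁ v → b ≁ v → u ≁ v
    far-from-non-edge⇒non-adjacent {a} {b} {u} {v} a≁b a≢b a≁u b≁u a≁v b≁v with adj G u v in uv
    ... | false = refl
    ... | true  = ⊥-elim (¬2K₁∪K₂ uv (≁-sym a≁u) (≁-sym b≁u) (≁-sym a≁v) (≁-sym b≁v) a≁b a≢b)

    module _ (P₅-free : Free G P₅) where

      ¬P₅ : ∀ {a b c d e} → a ~ b → b ~ c → c ~ d → d ~ e →
            a ≁ c → a ≁ d → a ≁ e → b ≁ d → b ≁ e → c ≁ e → ⊥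
      ¬P₅ {a} {b} {c} {d} {e} ab bc cd de a≁c a≁d a≁e b≁d b≁e c≁e =
        P₅-free (induced-copy P₅ vertex upper)
        where
        vertex : Fin 5 → Fin n
        vertex = a ∷ b ∷ c ∷ d ∷ e ∷ []

        upper : ∀ j (i : Fin′ j) → vertex (inject i) ≢ vertex j ×
                                    adj G (vertex (inject i)) (vertex j) ≡ adj P₅ (inject i) j
        upper 1F 0F = ~⇒≢ ab , ab
        upper 2F 0F = ≡.≢-sym (~≁⇒≢ (~-sym cd) (≁-sym a≁d)) , a≁c
        upper 2F 1F = ~⇒≢ bc , bc
        upper 3F 0F = ≡.≢-sym (~≁⇒≢ (~-sym de) (≁-sym a≁e)) , a≁d
        upper 3F 1F = ~≁⇒≢ ab a≁d , b≁d
        upper 3F 2F = ~⇒≢ cd , cd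
        upper 4F 0F = ~≁⇒≢ (~-sym ab) b≁e , a≁e
        upper 4F 1F = ~≁⇒≢ ab a≁e , b≁e
        upper 4F 2F = ~≁⇒≢ bc b≁e , c≁e
        upper 4F 3F = ~⇒≢ de , de

      module _ (undominated : ∀ p q → ∃ (Undominated p q)) where

        -- Two undominated vertices t, t′ of the edge uv would be adjacent; a vertex w undominated
        -- by u and t then completes a 2K₁ ∪ K₂ or the induced path u v w t′ t.
        undominated-unique : ∀ {u v t t′} → u ~ v → Undominated u v t → Undominated u v t′ → t ≡ t′
        undominated-unique {u} {v} {t} {t′} uv t-far@((_ , u≁t) , (_ , v≁t))
                                               t′-far@((_ , u≁t′) , (_ , v≁t′)) with t ≟ t′
        ... | yes t≡t′ = t≡t′
        ... | no t≢t′ with undominated u t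
        ...   | w , (w≢u , u≁w) , (w≢t , t≁w) with adj G v w in vw | adj G t′ w in t′w
        ...     | false | _     = ⊥-elim (¬2K₁∪K₂ uv u≁t u≁w v≁t vw t≁w (≡.≢-sym w≢t))
        ...     | true  | false = ⊥-elim (¬2K₁∪K₂ (far-from-edge⇒adjacent uv t-far t′-far t≢t′)
                                            (≁-sym u≁t) t≁w (≁-sym u≁t′) t′w u≁w (≡.≢-sym w≢u))
        ...     | true  | true  = ⊥-elim (¬P₅ uv vw (~-sym t′w)
                                            (~-sym (far-from-edge⇒adjacent uv t-far t′-far t≢t′))
                                            u≁w u≁t′ u≁t v≁t′ v≁t (≁-sym t≁w))

        separated-undominated-wins : ∀ {x y a r s} → x ~ y → x ~ a →
                                     Undominated x y r → Undominated a x s → r ≢ s → r ≁ s → CopsWin 2 G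
        separated-undominated-wins {x} {y} {a} xy xa r-far s-far r≢s r≁s =
          chase-wins xy xa escape-dominated
          where
          escape-dominated : ∀ {t t′} → Undominated x y t → Move G t t′ → Near a t′ ⊎ Near x t′
          escape-dominated {t} {t′} t-far t→t′
            with undominated-unique xy t-far r-far | dominated-or-undominated a x t′
          ... | _    | inj₁ dominated = dominated
          ... | refl | inj₂ t′-far with undominated-unique (~-sym xa) t′-far s-far
          ...   | refl with t→t′
          ...     | inj₁ r≡s = ⊥-elim (r≢s r≡s)
          ...     | inj₂ r~s = ⊥-elim (~-≁-absurd r~s r≁s)

        module _ (connected : Connected G) {q₁ q₂} (q₂-far : Far q₁ q₂) where

          Avoids : Fin n → Set
          Avoids w = q₁ ≁ w × q₂ ≁ w

          avoids? : ∀ w → Dec (Avoids w)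
          avoids? w = (adj G q₁ w Bool.≟ false) ×-dec (adj G q₂ w Bool.≟ false)

          avoids-independent : ∀ {u v} → Avoids u → Avoids v → u ≁ v
          avoids-independent (q₁≁u , q₂≁u) (q₁≁v , q₂≁v) =
            far-from-non-edge⇒non-adjacent (proj₂ q₂-far) (≡.≢-sym (proj₁ q₂-far)) q₁≁u q₂≁u q₁≁v q₂≁v

          -- If x missed y too, then y, like q₁ and q₂, misses the non-adjacent pair x, m; so q₁, q₂ miss y.
          adjacent-to-all-but-one : ∀ {x m y} → Avoids x → Avoids m → x ≢ m → ¬ Avoids y → m ≁ y → x ~ y
          adjacent-to-all-but-one {x} {m} {y} avoids-x@(q₁≁x , q₂≁x) avoids-m@(q₁≁m , q₂≁m)
                                  x≢m ¬avoids-y m≁y with adj G x y in xy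
          ... | true  = refl
          ... | false = ⊥-elim (¬avoids-y (far q₁≁x q₁≁m , far q₂≁x q₂≁m))
            where
            far : ∀ {q} → q ≁ x → q ≁ m → q ≁ y
            far q≁x q≁m = far-from-non-edge⇒non-adjacent (avoids-independent avoids-m avoids-x)
                            (≡.≢-sym x≢m) (≁-sym q≁m) (≁-sym q≁x) m≁y xy

          HasFarOutsider : Fin n → Set
          HasFarOutsider m = ∃ λ y → ¬ Avoids y × Far m y

          another-avoider : ∀ u v → ∃ λ x → Avoids x × x ≢ u × x ≢ v
          another-avoider with undominated q₁ q₂
          ... | c , (c≢q₁ , q₁≁c) , (c≢q₂ , q₂≁c) =
            one-of-three-avoids-two (irrefl G q₁ , ≁-sym (proj₂ q₂-far)) (proj₂ q₂-far , irrefl G q₂)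
              (q₁≁c , q₂≁c) (≡.≢-sym (proj₁ q₂-far)) (≡.≢-sym c≢q₁) (≡.≢-sym c≢q₂)

          -- p has a neighbour z outside Avoids; a vertex w undominated by z and another avoider q is either
          -- itself an avoider missed by z, or an outsider missed by q.
          another-with-far-outsider : ∀ {p} → Avoids p → ∃ λ m → Avoids m × m ≢ p × HasFarOutsider m
          another-with-far-outsider {p} avoids-p with another-avoider p p
          ... | q , avoids-q , q≢p , _ with has-neighbour (connected p q) (≡.≢-sym q≢p)
          ...   | z , pz with undominated z q | avoids? z
          ...     | _ | yes avoids-z = ⊥-elim (~-≁-absurd pz (avoids-independent avoids-p avoids-z))
          ...     | w , (w≢z , z≁w) , w-far-q | no ¬avoids-z with avoids? w
          ...       | yes avoids-w =
            w , avoids-w , ≡.≢-sym (~≁⇒≢ (~-sym pz) z≁w) , z , ¬avoids-z , far-sym (w≢z , z≁w)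
          ...       | no ¬avoids-w = q , avoids-q , q≢p , w , ¬avoids-w , w-far-q

          two-cops-win : CopsWin 2 G
          two-cops-win with another-avoider q₁ q₁
          ... | p , avoids-p , _ with another-with-far-outsider avoids-p
          ...   | m₁ , avoids-m₁ , _ , y₁ , ¬avoids-y₁ , m₁-far with another-with-far-outsider avoids-m₁
          ...     | m₂ , avoids-m₂ , m₂≢m₁ , y₂ , ¬avoids-y₂ , m₂-far with another-avoider m₁ m₂
          ...       | x , avoids-x , x≢m₁ , x≢m₂ =
            separated-undominated-wins
              (adjacent-to-all-but-one avoids-x avoids-m₁ x≢m₁ ¬avoids-y₁ (proj₂ m₁-far))
              (adjacent-to-all-but-one avoids-x avoids-m₂ x≢m₂ ¬avoids-y₂ (proj₂ m₂-far))
              ((≡.≢-sym x≢m₁ , avoids-independent avoids-x avoids-m₁) , far-sym m₁-far)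
              (far-sym m₂-far , (≡.≢-sym x≢m₂ , avoids-independent avoids-x avoids-m₂))
              (≡.≢-sym m₂≢m₁) (avoids-independent avoids-m₁ avoids-m₂)

theorem6p2p1 : ∀ (n : ℕ) (G : Graph n) → Connected G → Free G P₅ → Free G 2K₁∪K₂ →
    CopNumber≤ G 2
theorem6p2p1 zero    G _ _ _ = 0 , z≤n , (λ ()) , λ ()
theorem6p2p1 (suc n) G connected P₅-free 2K₁∪K₂-free with dominating-pair-or-undominated G
... | inj₁ (_ , _ , dominating) = 2 , ≤-refl , dominating-pair-wins G dominating
... | inj₂ undominated          =
  2 , ≤-refl , two-cops-win G 2K₁∪K₂-free P₅-free undominated connected (proj₁ (proj₂ (undominated 0F 0F)))
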